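{- Let $a_1,\dots,a_n$ be nonzero integers, $a_0$ a nonzero integer, and $p=\sum_{i=1}^n a_ix_i+a_0$. If $\sum_{i=1}^n a_i\le 0$ and $a_0<0$, then no numerical semigroup admits $p$, i.e. $\mathcal S(p)=\emptyset$.
   Context: A numerical semigroup is a subset $\Lambda\subseteq\mathbb N_0$ containing $0$, closed under addition, with finite complement in $\mathbb N_0$. $\Lambda$ admits $p$ if $p(s_1,\dots,s_n)\in\Lambda$ for all nonzero $s_1\geq\cdots\geq s_n$ in $\Lambda$; $\mathcal S(p)$ is the set of numerical semigroups admitting $p$. -}

module Defs where

open import Data.Nat as ℕ using (ℕ; _≤_)
open import Data.Fin as F using (Fin)
open import Data.Integer as ℤ using (ℤ; +_)
open import Data.Product using (Σ; _×_; ∃)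
open import Relation.Binary.PropositionalEquality using (_≡_; _≢_)
open import Relation.Nullary using (¬_)

∑ : (n : ℕ) → (Fin n → ℤ) → ℤ
∑ ℕ.zero f = + 0
∑ (ℕ.suc n) f = f F.zero ℤ.+ ∑ n (λ i → f (F.suc i))

record IsNumericalSemigroup (Λ : ℕ → Set) : Set where
  field
    has-zero : Λ 0
    closed+  : ∀ {a b} → Λ a → Λ b → Λ (a ℕ.+ b)
    cofinite : ∃ λ N → ∀ m → N ℕ.≤ m → Λ m

evalLin : (n : ℕ) → (Fin n → ℤ) → ℤ → (Fin n → ℕ) → ℤ
evalLin n a a₀ s = ∑ n (λ i → a i ℤ.* + s i) ℤ.+ a₀

_∈ℤ_ : ℤ → (ℕ → Set) → Set
z ∈ℤ Λ = ∃ λ k → (z ≡ + k) × Λ k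

Admits : (Λ : ℕ → Set) (n : ℕ) → (Fin n → ℤ) → ℤ → Set
Admits Λ n a a₀ =
  (s : Fin n → ℕ) →
  (∀ i → Λ (s i)) →
  (∀ i → s i ≢ 0) →
  (∀ i j → i F.≤ j → s j ℕ.≤ s i) →
  evalLin n a a₀ s ∈ℤ Λ

module Submission where

-- A numerical semigroup Λ contains every m ≥ N for some N, so
-- in particular the nonzero element c = N + 1.  The constant tuple
-- s₁ = ⋯ = sₙ = c is an admissible input for p, and the value of the
-- linear polynomial p there is
--     p(c,…,c) = c · (a₁ + ⋯ + aₙ) + a₀.
-- Since c ≥ 0, Σ aᵢ ≤ 0 and a₀ < 0, this value is negative, whereas every
-- element of Λ is a natural number.  Hence Λ cannot admit p.
--
-- The theorem combines these with the choice of c.  (The hypotheses that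
-- the coefficients are nonzero are not needed.)

open import Defs
open import Data.Nat using (ℕ; zero; suc; z≤n)
open import Data.Nat.Properties using (n≤1+n; ≤-refl)
open import Data.Fin using (Fin) renaming (zero to fzero; suc to fsuc)
open import Data.Integer using (ℤ; +_; _+_; _*_; _≤_; _<_; +≤+)
open import Data.Integer.Properties
  using (*-distribʳ-+; *-monoʳ-≤-nonNeg; +-mono-≤-<; ≤-<-trans; <-irrefl)
open import Data.Product using (_,_)
open import Relation.Binary.PropositionalEquality
  using (_≡_; _≢_; refl; sym; cong; subst; module ≡-Reasoning)
open import Relation.Nullary using (¬_)

∑-*ʳ : ∀ n (a : Fin n → ℤ) c → ∑ n (λ i → a i * c) ≡ ∑ n a * c
∑-*ʳ zero    a c = refl
∑-*ʳ (suc n) a c = begin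
  a fzero * c + ∑ n (λ i → a (fsuc i) * c)  ≡⟨ cong (_+_ (a fzero * c)) (∑-*ʳ n (λ i → a (fsuc i)) c) ⟩
  a fzero * c + ∑ n (λ i → a (fsuc i)) * c  ≡⟨ *-distribʳ-+ c (a fzero) (∑ n (λ i → a (fsuc i))) ⟨
  (a fzero + ∑ n (λ i → a (fsuc i))) * c    ∎
  where open ≡-Reasoning

evalLin-constant : ∀ n (a : Fin n → ℤ) a₀ c →
  evalLin n a a₀ (λ _ → c) ≡ ∑ n a * + c + a₀
evalLin-constant n a a₀ c = cong (_+ a₀) (∑-*ʳ n a (+ c))

evalLin-constant-negative : ∀ n (a : Fin n → ℤ) a₀ c →
  ∑ n a ≤ + 0 → a₀ < + 0 → evalLin n a a₀ (λ _ → c) < + 0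
evalLin-constant-negative n a a₀ c ∑a≤0 a₀<0 =
  subst (_< + 0) (sym (evalLin-constant n a a₀ c))
    (+-mono-≤-< (*-monoʳ-≤-nonNeg (+ c) ∑a≤0) a₀<0)

negative-∉ : ∀ {Λ : ℕ → Set} {z} → z < + 0 → ¬ (z ∈ℤ Λ)
negative-∉ z<0 (k , refl , _) = <-irrefl refl (≤-<-trans (+≤+ z≤n) z<0)

mainTheorem7 : (n : ℕ) (a : Fin n → ℤ) (a₀ : ℤ) →
    (∀ i → a i ≢ + 0) → a₀ ≢ + 0 →
    ∑ n a ≤ + 0 → a₀ < + 0 →
    (Λ : ℕ → Set) → IsNumericalSemigroup Λ → ¬ Admits Λ n a a₀
mainTheorem7 n a a₀ _ _ ∑a≤0 a₀<0 Λ isNS admits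
  with IsNumericalSemigroup.cofinite isNS
... | N , ≥N⇒∈Λ =
  negative-∉ (evalLin-constant-negative n a a₀ c ∑a≤0 a₀<0)
    (admits (λ _ → c) c∈Λ c≢0 (λ _ _ _ → ≤-refl))
  where
  c : ℕ
  c = suc N
  c∈Λ : Fin n → Λ c
  c∈Λ _ = ≥N⇒∈Λ c (n≤1+n N)
  c≢0 : Fin n → c ≢ 0
  c≢0 _ ()
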